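{- Let $S$ be a set and $f\colon 2^S\to 2^S$ monotonic with respect to $\subseteq$. Then $\mu f=\bigcup\{X\in 2^S\mid X \text{ is well-supported for } f\}$.
   Context: $\mu f$ is the least fixpoint of $f$. A support ordering for $f$ is a pair $(X,\prec)$ with $X\subseteq S$ and $\prec\subseteq X\times X$ such that for every $x\in X$, $x\in f(\{x'\in X\mid x'\prec x\})$. $X$ is well-supported for $f$ if there is a well-founded (every nonempty subset has a minimal element) $\prec\subseteq X\times X$ with $(X,\prec)$ a support ordering for $f$. The Axiom of Choice is assumed. -}

module Defs where

open import Level using (Level; suc)
open import Data.Product using (Σ; _×_; ∃; ∃-syntax; _,_)
open import Relation.Nullary using (¬_)
open import Relation.Unary using (Pred; _∈_; _⊆_; _≐_)
open import Relation.Binary.Core using (Rel)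

Monotonic : ∀ {ℓ} {S : Set ℓ} → (Pred S ℓ → Pred S ℓ) → Set (suc ℓ)
Monotonic f = ∀ {A B} → A ⊆ B → f A ⊆ f B

IsLeastFixpoint : ∀ {ℓ} {S : Set ℓ} → (Pred S ℓ → Pred S ℓ) → Pred S ℓ → Set (suc ℓ)
IsLeastFixpoint f M = (f M ≐ M) × (∀ P → f P ≐ P → M ⊆ P)

IsSupportOrdering : ∀ {ℓ} {S : Set ℓ} → (Pred S ℓ → Pred S ℓ) → Pred S ℓ → Rel S ℓ → Set ℓ
IsSupportOrdering f X _≺_ =
  (∀ {x y} → x ≺ y → (x ∈ X) × (y ∈ X)) ×
  (∀ {x} → x ∈ X → x ∈ f (λ x' → (x' ∈ X) × (x' ≺ x)))

WellFoundedOn : ∀ {ℓ} {S : Set ℓ} → Pred S ℓ → Rel S ℓ → Set (suc ℓ)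
WellFoundedOn {S = S} X _≺_ =
  ∀ (A : Pred S _) → A ⊆ X → (∃[ a ] a ∈ A) →
  ∃[ m ] (m ∈ A × (∀ {a} → a ∈ A → ¬ (a ≺ m)))

WellSupported : ∀ {ℓ} {S : Set ℓ} → (Pred S ℓ → Pred S ℓ) → Pred S ℓ → Set (suc ℓ)
WellSupported f X = ∃[ _≺_ ] (WellFoundedOn X _≺_ × IsSupportOrdering f X _≺_)

WSUnion : ∀ {ℓ} {S : Set ℓ} → (Pred S ℓ → Pred S ℓ) → Pred S (suc ℓ)
WSUnion f x = ∃[ X ] (WellSupported f X × x ∈ X)

{-# OPTIONS --safe #-}
-- Every element of a well-supported set lies in μ f, by well-founded induction along its support
-- ordering. Conversely, μ f is itself well-supported: the transfinite iterates of f (closed under f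
-- and under unions) form a chain of subsets of μ f, and x ≺ y, "x enters the chain strictly before
-- y", is well-founded and supports every y ∈ μ f. Excluded middle one level up lets the large
-- propositions used along the way be resized to level ℓ, so no ordinals are needed.
module Submission where

open import Defs
open import Level using (suc; Lift; lift; lower)
open import Axiom.ExcludedMiddle using (ExcludedMiddle)
open import Relation.Unary using (Pred; _≐_; _∈_; _∉_; _⊆_; ∁)
open import Relation.Binary.Core using (Rel)
open import Relation.Binary.PropositionalEquality using (_≢_; refl)
open import Relation.Nullary using (¬_; yes; no)
open import Relation.Nullary.Decidable using (True; toWitness; fromWitness; decidable-stable)
open import Data.Product using (_×_; ∃-syntax; _,_; proj₁; proj₂)
open import Data.Sum using (_⊎_; inj₁; inj₂)
open import Data.Empty using (⊥-elim)

module _ {ℓ} (em : ExcludedMiddle ℓ) {S : Set ℓ} where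

  ⊈⇒∃∉ : {A B : Pred S ℓ} → ¬ A ⊆ B → ∃[ x ] (x ∈ A × x ∉ B)
  ⊈⇒∃∉ {A} {B} A⊈B with em {∃[ x ] (x ∈ A × x ∉ B)}
  ... | yes witness = witness
  ... | no ∄ = ⊥-elim (A⊈B λ {x} x∈A → decidable-stable em λ x∉B → ∄ (x , x∈A , x∉B))

  wellSupported⊆prefixpoint : {f : Pred S ℓ → Pred S ℓ} → Monotonic f →
    ∀ {X P} → WellSupported f X → f P ⊆ P → X ⊆ P
  wellSupported⊆prefixpoint mono {X} {P} (_≺_ , wf , _ , supports) fP⊆P {x} x∈X =
    decidable-stable em λ x∉P →
      let m , (m∈X , m∉P) , minimal = wf (λ a → a ∈ X × a ∉ P) proj₁ (x , x∈X , x∉P)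
          predecessors⊆P : (λ x′ → x′ ∈ X × x′ ≺ m) ⊆ P
          predecessors⊆P (x′∈X , x′≺m) =
            decidable-stable em λ x′∉P → minimal (x′∈X , x′∉P) x′≺m
      in m∉P (fP⊆P (mono predecessors⊆P (supports m∈X)))

module Tower {ℓ} (em : ExcludedMiddle ℓ) (em₁ : ExcludedMiddle (suc ℓ))
  {S : Set ℓ} (f : Pred S ℓ → Pred S ℓ) (mono : Monotonic f) where

  -- Under excluded middle a large proposition is equivalent to ⊤ or ⊥, hence to a small one.
  ⌈_⌉ : Set (suc ℓ) → Set ℓ
  ⌈ P ⌉ = Lift ℓ (True (em₁ {P}))

  resize : ∀ {P} → P → ⌈ P ⌉
  resize {P} p = lift (fromWitness {a? = em₁ {P}} p)

  unresize : ∀ {P} → ⌈ P ⌉ → P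
  unresize {P} p = toWitness {a? = em₁ {P}} (lower p)

  ⋃ : Pred (Pred S ℓ) ℓ → Pred S ℓ
  ⋃ 𝒢 x = ⌈ ∃[ Q ] (Q ∈ 𝒢 × x ∈ Q) ⌉

  ⋃-upper : ∀ {𝒢 Q} → Q ∈ 𝒢 → Q ⊆ ⋃ 𝒢
  ⋃-upper Q∈𝒢 x∈Q = resize (_ , Q∈𝒢 , x∈Q)

  ⋃-least : ∀ {𝒢} {C : Pred S ℓ} → (∀ {Q} → Q ∈ 𝒢 → Q ⊆ C) → ⋃ 𝒢 ⊆ C
  ⋃-least Q⊆C x∈⋃ = let _ , Q∈𝒢 , x∈Q = unresize x∈⋃ in Q⊆C Q∈𝒢 x∈Q

  data Tower : Pred S ℓ → Set (suc ℓ) where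
    step : ∀ {Q} → Tower Q → Tower (f Q)
    sup  : ∀ 𝒢 → (∀ {Q} → Q ∈ 𝒢 → Tower Q) → Tower (⋃ 𝒢)

  tower-inflationary : ∀ {Q} → Tower Q → Q ⊆ f Q
  tower-inflationary (step t) = mono (tower-inflationary t)
  tower-inflationary (sup 𝒢 t) =
    ⋃-least λ Q∈𝒢 x∈Q → mono (⋃-upper Q∈𝒢) (tower-inflationary (t Q∈𝒢) x∈Q)

  tower⊆prefixpoint : ∀ {P Q} → f P ⊆ P → Tower Q → Q ⊆ P
  tower⊆prefixpoint fP⊆P (step t) x∈fQ = fP⊆P (mono (tower⊆prefixpoint fP⊆P t) x∈fQ)
  tower⊆prefixpoint fP⊆P (sup 𝒢 t) = ⋃-least λ Q∈𝒢 → tower⊆prefixpoint fP⊆P (t Q∈𝒢)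

  -- As for the Bourbaki–Witt theorem: every tower member is extreme, so the tower is a chain.
  Extreme : Pred S ℓ → Set (suc ℓ)
  Extreme Q = ∀ {R} → Tower R → R ⊆ Q → ¬ Q ⊆ R → f R ⊆ Q

  extreme-split : ∀ {Q R} → Extreme Q → Tower R → R ⊆ Q ⊎ f Q ⊆ R
  extreme-split {Q} ext (step {R} t) with extreme-split ext t
  ... | inj₂ fQ⊆R = inj₂ λ x∈fQ → tower-inflationary t (fQ⊆R x∈fQ)
  ... | inj₁ R⊆Q with em {Q ⊆ R}
  ...   | yes Q⊆R = inj₂ (mono Q⊆R)
  ...   | no Q⊈R = inj₁ (ext t R⊆Q Q⊈R)
  extreme-split {Q} ext (sup 𝒢 t) with em₁ {∃[ R ] (R ∈ 𝒢 × f Q ⊆ R)}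
  ... | yes (R , R∈𝒢 , fQ⊆R) = inj₂ λ x∈fQ → ⋃-upper R∈𝒢 (fQ⊆R x∈fQ)
  ... | no ∄ = inj₁ (⋃-least members⊆Q)
    where
    members⊆Q : ∀ {R} → R ∈ 𝒢 → R ⊆ Q
    members⊆Q {R} R∈𝒢 with extreme-split ext (t R∈𝒢)
    ... | inj₁ R⊆Q = R⊆Q
    ... | inj₂ fQ⊆R = ⊥-elim (∄ (R , R∈𝒢 , fQ⊆R))

  tower-extreme : ∀ {Q} → Tower Q → Extreme Q
  tower-extreme (step t) tR _ fQ⊈R with extreme-split (tower-extreme t) tR
  ... | inj₁ R⊆Q = mono R⊆Q
  ... | inj₂ fQ⊆R = ⊥-elim (fQ⊈R fQ⊆R)
  tower-extreme (sup 𝒢 t) tR _ ⋃⊈R with ⊈⇒∃∉ em ⋃⊈R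
  ... | x , x∈⋃ , x∉R with unresize x∈⋃
  ... | Q , Q∈𝒢 , x∈Q with extreme-split (tower-extreme (t Q∈𝒢)) tR
  ... | inj₁ R⊆Q = λ y∈fR → ⋃-upper Q∈𝒢
          (tower-extreme (t Q∈𝒢) tR R⊆Q (λ Q⊆R → x∉R (Q⊆R x∈Q)) y∈fR)
  ... | inj₂ fQ⊆R = ⊥-elim (x∉R (fQ⊆R (tower-inflationary (t Q∈𝒢) x∈Q)))

  tower-total : ∀ {Q R} → Tower Q → Tower R → R ⊆ Q ⊎ f Q ⊆ R
  tower-total tQ = extreme-split (tower-extreme tQ)

  largestTowerIn : Pred S ℓ → Pred S ℓ
  largestTowerIn C = ⋃ λ Q → ⌈ Tower Q ⌉ × Q ⊆ C

  largestTowerIn-tower : ∀ {C} → Tower (largestTowerIn C)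
  largestTowerIn-tower = sup _ λ (tQ , _) → unresize tQ

  largestTowerIn-⊆ : ∀ {C} → largestTowerIn C ⊆ C
  largestTowerIn-⊆ = ⋃-least proj₂

  largestTowerIn-greatest : ∀ {C Q} → Tower Q → Q ⊆ C → Q ⊆ largestTowerIn C
  largestTowerIn-greatest tQ Q⊆C = ⋃-upper (resize tQ , λ {x} → Q⊆C {x})

  _⊏_ : Rel S ℓ
  x ⊏ y = ⌈ ∃[ Q ] (Tower Q × x ∈ Q × y ∉ Q) ⌉

  module LeastFixpoint {M} (lfp : IsLeastFixpoint f M) where

    tower⊆lfp : ∀ {Q} → Tower Q → Q ⊆ M
    tower⊆lfp = tower⊆prefixpoint (proj₁ (proj₁ lfp))

    lfp⊆largestTowerIn : ∀ {C} → f (largestTowerIn C) ⊆ C → M ⊆ C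
    lfp⊆largestTowerIn fQ⊆C x∈M = largestTowerIn-⊆ (proj₂ lfp _
      ( largestTowerIn-greatest (step largestTowerIn-tower) fQ⊆C
      , tower-inflationary largestTowerIn-tower ) x∈M)

    _≺_ : Rel S ℓ
    x ≺ y = x ∈ M × y ∈ M × x ⊏ y

    -- y ∈ f Q holds for Q the largest tower member missing y.
    ≺-supports : ∀ {y} → y ∈ M → y ∈ f (λ x → x ∈ M × x ≺ y)
    ≺-supports {y} y∈M = mono before-y⊆predecessors y∈fQ
      where
      before-y⊆predecessors : largestTowerIn (_≢ y) ⊆ (λ x → x ∈ M × x ≺ y)
      before-y⊆predecessors x∈Q =
        let x∈M = tower⊆lfp largestTowerIn-tower x∈Q
        in x∈M , x∈M , y∈M ,
           resize (_ , largestTowerIn-tower , x∈Q , λ y∈Q → largestTowerIn-⊆ y∈Q refl)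
      y∈fQ : y ∈ f (largestTowerIn (_≢ y))
      y∈fQ = decidable-stable em λ y∉fQ →
        lfp⊆largestTowerIn {_≢ y} (λ { x∈fQ refl → y∉fQ x∈fQ }) y∈M refl

    -- A minimal element of A is one in f Q, for Q the largest tower member disjoint from A.
    ≺-wellFounded : WellFoundedOn M _≺_
    ≺-wellFounded A A⊆M (a , a∈A) with em {∃[ m ] (m ∈ f (largestTowerIn (∁ A)) × m ∈ A)}
    ... | no ∄ = ⊥-elim
          (lfp⊆largestTowerIn (λ m∈fQ m∈A → ∄ (_ , m∈fQ , m∈A)) (A⊆M a∈A) a∈A)
    ... | yes (m , m∈fQ , m∈A) = m , m∈A , minimal
      where
      minimal : ∀ {x} → x ∈ A → ¬ x ≺ m
      minimal x∈A (_ , _ , x⊏m) with unresize x⊏m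
      ... | R , tR , x∈R , m∉R with tower-total largestTowerIn-tower tR
      ... | inj₁ R⊆Q = largestTowerIn-⊆ (R⊆Q x∈R) x∈A
      ... | inj₂ fQ⊆R = m∉R (fQ⊆R m∈fQ)

    lfp-wellSupported : WellSupported f M
    lfp-wellSupported = _≺_ , ≺-wellFounded , (λ (x∈M , y∈M , _) → x∈M , y∈M) , ≺-supports

corollary1 : ∀ {ℓ} → ExcludedMiddle ℓ → ExcludedMiddle (suc ℓ) →
    (S : Set ℓ) (f : Pred S ℓ → Pred S ℓ) → Monotonic f →
    (M : Pred S ℓ) → IsLeastFixpoint f M →
    M ≐ WSUnion f
corollary1 em em₁ S f mono M lfp =
    (λ x∈M → M , lfp-wellSupported , x∈M)
  , λ (X , X-wellSupported , x∈X) →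
      wellSupported⊆prefixpoint em mono X-wellSupported (proj₁ (proj₁ lfp)) x∈X
  where open Tower em em₁ f mono
        open LeastFixpoint lfp
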